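{- Every graph $G$ has slope-number $\operatorname{sn}(G)\leq\tfrac{1}{2}\operatorname{bw}(G)\,(\operatorname{bw}(G)+1)+1$.
   Context: A (straight-line) drawing of a graph maps its vertices to distinct points in the plane and represents each edge by the closed line segment between its endpoints, such that each edge segment intersects no vertex other than its own endpoints. The slope of an edge is the angle in $[0,\pi)$ from the $x$-axis to the line containing it. The slope-number $\operatorname{sn}(G)$ is the minimum number of distinct edge slopes over all drawings of $G$. The width of a vertex ordering $(v_1,\dots,v_n)$ of $G$ is $\max\{|i-j| : v_iv_j\in E(G)\}$; the bandwidth $\operatorname{bw}(G)$ is the minimum width of a vertex ordering of $G$. -}

module Defs where

open import Level using (0ℓ)
open import Data.Nat using (ℕ; _⊔_; ∣_-_∣)
open import Data.Bool using (Bool; true; false; if_then_else_)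
open import Data.Fin using (Fin; toℕ)
open import Data.List using (List; foldr; map; concatMap; allFin)
open import Data.Product using (_×_; ∃; ∃-syntax; _,_)
open import Data.Sum using (_⊎_)
open import Relation.Nullary using (¬_)
open import Relation.Binary.PropositionalEquality using (_≡_)
open import Data.Fin.Permutation using (Permutation′; _⟨$⟩ʳ_)
open import Algebra.Bundles using (CommutativeRing)

-- The real numbers, axiomatised as a Dedekind-complete ordered field.
-- (agda-stdlib has no reals; every complete ordered field is isomorphic
-- to ℝ, so the theorem quantifies over all of them.)

record RealField : Set₁ where
  field
    cring : CommutativeRing 0ℓ 0ℓ
  open CommutativeRing cring public hiding (ring)
  field
    _≤ᵣ_      : Carrier → Carrier → Set
    0≉1       : ¬ (0# ≈ 1#)
    inverse   : ∀ x → ¬ (x ≈ 0#) → ∃[ y ] (x * y ≈ 1#)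
    ≤-resp-≈  : ∀ {x x′ y y′} → x ≈ x′ → y ≈ y′ → x ≤ᵣ y → x′ ≤ᵣ y′
    ≤-refl    : ∀ x → x ≤ᵣ x
    ≤-antisym : ∀ {x y} → x ≤ᵣ y → y ≤ᵣ x → x ≈ y
    ≤-trans   : ∀ {x y z} → x ≤ᵣ y → y ≤ᵣ z → x ≤ᵣ z
    ≤-total   : ∀ x y → (x ≤ᵣ y) ⊎ (y ≤ᵣ x)
    ≤-+       : ∀ {x y} z → x ≤ᵣ y → (x + z) ≤ᵣ (y + z)
    ≤-*       : ∀ {x y} → 0# ≤ᵣ x → 0# ≤ᵣ y → 0# ≤ᵣ (x * y)
    sup       : (P : Carrier → Set) → ∃[ x ] P x →
                ∃[ b ] (∀ x → P x → x ≤ᵣ b) →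
                ∃[ s ] ((∀ x → P x → x ≤ᵣ s) ×
                        (∀ b → (∀ x → P x → x ≤ᵣ b) → s ≤ᵣ b))

record Graph (n : ℕ) : Set where
  field
    adj     : Fin n → Fin n → Bool
    symm    : ∀ u v → adj u v ≡ adj v u
    irrefl  : ∀ u → adj u u ≡ false
open Graph public

Edge : ∀ {n} → Graph n → Fin n → Fin n → Set
Edge G u v = adj G u v ≡ true

-- Bandwidth.  A vertex ordering (v₁,…,vₙ) is a bijection σ from
-- positions to vertices; its width is the maximum of |i - j| over
-- positions i, j with σ i σ j an edge (0 if there are no edges).

width : ∀ {n} → Graph n → Permutation′ n → ℕ
width {n} G σ =
  foldr _⊔_ 0
    (concatMap (λ i → map (λ j → if adj G (σ ⟨$⟩ʳ i) (σ ⟨$⟩ʳ j)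
                                   then ∣ toℕ i - toℕ j ∣ else 0)
                          (allFin n))
               (allFin n))

BandwidthAtMost : ∀ {n} → Graph n → ℕ → Set
BandwidthAtMost {n} G k = ∃[ σ ] (width G σ Data.Nat.≤ k)
  where import Data.Nat

module _ (R : RealField) where
  open RealField R

  Point : Set
  Point = Carrier × Carrier

  OnSegment : Point → Point → Point → Set
  OnSegment (px , py) (ax , ay) (bx , by) =
    ∃[ t ] ((0# ≤ᵣ t) × (t ≤ᵣ 1#) ×
            (px ≈ ax + t * (bx - ax)) × (py ≈ ay + t * (by - ay)))

  record Drawing {n : ℕ} (G : Graph n) : Set where
    field
      pos      : Fin n → Point
      distinct : ∀ u v → ¬ (u ≡ v) →
                 ¬ ((Data.Product.proj₁ (pos u) ≈ Data.Product.proj₁ (pos v)) ×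
                    (Data.Product.proj₂ (pos u) ≈ Data.Product.proj₂ (pos v)))
      noVertexOnEdge : ∀ u v w → Edge G u v → ¬ (w ≡ u) → ¬ (w ≡ v) →
                       ¬ OnSegment (pos w) (pos u) (pos v)

  -- A slope is represented by a nonzero direction vector (dx, dy);
  -- segment a b has slope d iff b - a is parallel to d.
  HasSlope : Point → Point → Point → Set
  HasSlope (ax , ay) (bx , by) (dx , dy) =
    (bx - ax) * dy ≈ (by - ay) * dx

  NonZeroDir : Point → Set
  NonZeroDir (dx , dy) = ¬ ((dx ≈ 0#) × (dy ≈ 0#))

  UsesAtMostSlopes : ∀ {n} {G : Graph n} → Drawing G → ℕ → Set
  UsesAtMostSlopes {n} {G} D m =
    Data.Product.Σ (Fin m → Point) λ s → ((∀ (i : Fin m) → NonZeroDir (s i)) ×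
            (∀ (u v : Fin n) → Edge G u v →
               ∃[ i ] HasSlope (Drawing.pos D u) (Drawing.pos D v) (s i)))

  SlopeNumberAtMost : ∀ {n} → Graph n → ℕ → Set
  SlopeNumberAtMost G m = Data.Product.Σ (Drawing G) λ D → UsesAtMostSlopes {G = G} D m

{-# OPTIONS --safe #-}
-- Take an ordering of width k and put p = ⌊k/2⌋ + 1. The vertex at position i is drawn at
-- (i, (k+2)^(i mod p)). The slope of an edge from position i to i + d (1 ≤ d ≤ k) depends
-- only on i mod p and d, and is horizontal when d = p, so at most 1 + p(k-1) ≤ k(k+1)/2 + 1
-- slopes occur. A vertex at position m with i < m < j ≤ i + k lying on the edge from i to j
-- would satisfy (j-i) y_m = (j-m) y_i + (m-i) y_j; as these weights are smaller than the base
-- k+2, the three exponents must agree, so p divides m - i and j - m and j - i ≥ 2p > k.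
-- Only the ordered-ring axioms of R are used: all coordinates are images of naturals.
module Submission where

open import Defs
open import Algebra.Bundles using (CommutativeRing)
open import Data.Bool using (true; if_then_else_)
open import Data.Nat as ℕ using (ℕ; zero; suc)
import Data.Nat.Properties as ℕ
open import Data.Fin using (Fin; toℕ)
open import Data.Fin.Permutation using (Permutation′; _⟨$⟩ʳ_; _⟨$⟩ˡ_; inverseʳ)
open import Data.List
  using (List; _∷_; length; lookup; filter; applyUpTo; upTo; cartesianProductWith)
open import Data.List.Membership.Propositional using (_∈_; lose)
open import Data.List.Relation.Unary.Any as Any using (Any; here; there)
open import Data.Product using (_×_; _,_; ∃-syntax; proj₁)
open import Data.Sum using (inj₁; inj₂; [_,_]′)
open import Relation.Nullary using (¬_; yes; no; ¬?)
open import Relation.Binary.PropositionalEquality as ≡ using (_≡_; _≢_)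

module Arithmetic where

  open import Data.Nat
  open import Data.Nat.Properties
  open import Data.Nat.DivMod
  open import Data.Nat.Divisibility using (_∣_; divides; ∣m+n∣m⇒∣n; n∣m*n; ∣⇒≤)
  open import Data.Nat.Tactic.RingSolver using (solve-∀)
  open import Algebra.Properties.CommutativeSemigroup *-commutativeSemigroup using (xy∙z≈xz∙y)
  open import Data.List using ([]; map)
  open import Data.List.Properties using (filter-notAll; length-applyUpTo; length-++; length-map)
  open import Data.List.Membership.Propositional.Properties using (∈-applyUpTo⁺)
  open ≡

  [m+n]%o≡m%o⇒o∣n : ∀ m n o .{{_ : NonZero o}} → (m + n) % o ≡ m % o → o ∣ n
  [m+n]%o≡m%o⇒o∣n m n o eq = ∣m+n∣m⇒∣n (divides ((m + n) / o) quotients) (n∣m*n (m / o))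
    where
    open ≡-Reasoning
    quotients : m / o * o + n ≡ (m + n) / o * o
    quotients = +-cancelˡ-≡ (m % o) _ _ (begin
      m % o + (m / o * o + n)        ≡⟨ +-assoc (m % o) _ n ⟨
      m % o + m / o * o + n          ≡⟨ cong (_+ n) (m≡m%n+[m/n]*n m o) ⟨
      m + n                          ≡⟨ m≡m%n+[m/n]*n (m + n) o ⟩
      (m + n) % o + (m + n) / o * o  ≡⟨ cong (_+ (m + n) / o * o) eq ⟩
      m % o + (m + n) / o * o        ∎)

  length-cartesianProductWith : ∀ {A B C : Set} (f : A → B → C) xs ys →
    length (cartesianProductWith f xs ys) ≡ length xs * length ys
  length-cartesianProductWith f []       ys = refl
  length-cartesianProductWith f (x ∷ xs) ys = trans (length-++ (map (f x) ys))
    (cong₂ _+_ (length-map (f x) ys) (length-cartesianProductWith f xs ys))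

  module _ {b : ℕ} (1<b : 1 < b) where

    private instance
      b≢0 : NonZero b
      b≢0 = >-nonZero (<-trans z<s 1<b)

    m*b^x<b^y : ∀ {m x y} → m < b → x < y → m * b ^ x < b ^ y
    m*b^x<b^y {m} {x} {y} m<b x<y = begin-strict
      m * b ^ x  <⟨ *-monoˡ-< (b ^ x) {{m^n≢0 b x}} m<b ⟩
      b * b ^ x  ≤⟨ ^-monoʳ-≤ b x<y ⟩
      b ^ y      ∎
      where open ≤-Reasoning

    exponent-≤ : ∀ {m c x y} r .{{_ : NonZero c}} → m < b →
                 m * b ^ y ≡ c * b ^ x + r → x ≤ y
    exponent-≤ {m} {c} {x} {y} r m<b eq = ≮⇒≥ λ y<x → <-irrefl eq (begin-strict
      m * b ^ y      <⟨ m*b^x<b^y m<b y<x ⟩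
      b ^ x          ≤⟨ m≤n*m (b ^ x) c ⟩
      c * b ^ x      ≤⟨ m≤m+n _ r ⟩
      c * b ^ x + r  ∎)
      where open ≤-Reasoning

    exponent-≥ : ∀ {a c x y z} .{{_ : NonZero c}} → x ≤ y → z ≤ y →
                 (c + a) * b ^ y ≡ c * b ^ x + a * b ^ z → y ≤ x
    exponent-≥ {a} {c} {x} {y} {z} x≤y z≤y eq = ≮⇒≥ λ x<y → <-irrefl (sym eq) (begin-strict
      c * b ^ x + a * b ^ z  <⟨ +-mono-<-≤ (*-monoʳ-< c (^-monoʳ-< b 1<b x<y))
                                           (*-monoʳ-≤ a (^-monoʳ-≤ b z≤y)) ⟩
      c * b ^ y + a * b ^ y  ≡⟨ *-distribʳ-+ (b ^ y) c a ⟨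
      (c + a) * b ^ y        ∎)
      where open ≤-Reasoning

    weighted-mean-of-powers : ∀ {a c x y z} .{{_ : NonZero a}} .{{_ : NonZero c}} → a + c < b →
                              (a + c) * b ^ y ≡ c * b ^ x + a * b ^ z → x ≡ y × z ≡ y
    weighted-mean-of-powers {a} {c} {x} {y} {z} a+c<b eq =
      ≤-antisym x≤y (exponent-≥ x≤y z≤y (trans (cong (_* b ^ y) (+-comm c a)) eq)) ,
      ≤-antisym z≤y (exponent-≥ z≤y x≤y eq′)
      where
      eq′ : (a + c) * b ^ y ≡ a * b ^ z + c * b ^ x
      eq′ = trans eq (+-comm (c * b ^ x) (a * b ^ z))
      x≤y = exponent-≤ (a * b ^ z) a+c<b eq
      z≤y = exponent-≤ (c * b ^ x) a+c<b eq′

  module Heights (k : ℕ) where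

    period : ℕ
    period = suc (k / 2)

    k<period+period : k < period + period
    k<period+period = begin-strict
      k                  ≡⟨ m≡m%n+[m/n]*n k 2 ⟩
      k % 2 + k / 2 * 2  <⟨ +-monoˡ-< (k / 2 * 2) (m%n<n k 2) ⟩
      2 + k / 2 * 2      ≡⟨ 2+2h≡[1+h]+[1+h] (k / 2) ⟩
      period + period    ∎
      where
      open ≤-Reasoning
      2+2h≡[1+h]+[1+h] : ∀ h → 2 + h * 2 ≡ suc h + suc h
      2+2h≡[1+h]+[1+h] = solve-∀

    period*[k∸1]≤k[k+1]/2 : period * (k ∸ 1) ≤ k * (k + 1) / 2
    period*[k∸1]≤k[k+1]/2 = begin
      period * (k ∸ 1)          ≡⟨ m*n/n≡m (period * (k ∸ 1)) 2 ⟨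
      period * (k ∸ 1) * 2 / 2  ≤⟨ /-mono-≤ doubled ≤-refl ⟩
      k * (k + 1) / 2           ∎
      where
      open ≤-Reasoning
      [2+n][n∸1]≤n[n+1] : ∀ n → (2 + n) * (n ∸ 1) ≤ n * (n + 1)
      [2+n][n∸1]≤n[n+1] zero    = z≤n
      [2+n][n∸1]≤n[n+1] (suc n) = subst ((2 + suc n) * n ≤_) (expand n) (m≤m+n _ 2)
        where
        expand : ∀ n → (2 + suc n) * n + 2 ≡ suc n * (suc n + 1)
        expand = solve-∀
      doubled : period * (k ∸ 1) * 2 ≤ k * (k + 1)
      doubled = begin
        period * (k ∸ 1) * 2  ≡⟨ xy∙z≈xz∙y period (k ∸ 1) 2 ⟩
        period * 2 * (k ∸ 1)  ≤⟨ *-monoˡ-≤ (k ∸ 1) (+-monoʳ-≤ 2 (m/n*n≤m k 2)) ⟩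
        (2 + k) * (k ∸ 1)     ≤⟨ [2+n][n∸1]≤n[n+1] k ⟩
        k * (k + 1)           ∎

    height : ℕ → ℕ
    height i = (2 + k) ^ (i % period)

    height-periodic : ∀ i → height (i + period) ≡ height i
    height-periodic i = cong ((2 + k) ^_) ([m+n]%n≡m%n i period)

    height-% : ∀ i → height (i % period) ≡ height i
    height-% i = cong ((2 + k) ^_) (m%n%n≡m%n i period)

    height-%-+ : ∀ i d → height (i % period + d) ≡ height (i + d)
    height-%-+ i d = cong ((2 + k) ^_) (begin
      (i % p + d) % p          ≡⟨ %-distribˡ-+ (i % p) d p ⟩
      (i % p % p + d % p) % p  ≡⟨ cong (λ r → (r + d % p) % p) (m%n%n≡m%n i p) ⟩
      (i % p + d % p) % p      ≡⟨ %-distribˡ-+ i d p ⟨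
      (i + d) % p              ∎)
      where
      open ≡-Reasoning
      p = period

    height-not-weighted-mean : ∀ i a c .{{_ : NonZero a}} .{{_ : NonZero c}} → a + c ≤ k →
      (a + c) * height (i + a) ≢ c * height i + a * height (i + a + c)
    height-not-weighted-mean i a c a+c≤k eq
      with weighted-mean-of-powers (s≤s (s≤s z≤n)) (s≤s (m≤n⇒m≤1+n a+c≤k)) eq
    ... | i≡i+a , i+a+c≡i+a = <⇒≱ k<period+period (begin
      period + period  ≤⟨ +-mono-≤ (∣⇒≤ ([m+n]%o≡m%o⇒o∣n i a period (sym i≡i+a)))
                                    (∣⇒≤ ([m+n]%o≡m%o⇒o∣n (i + a) c period i+a+c≡i+a)) ⟩
      a + c            ≤⟨ a+c≤k ⟩
      k                ∎)
      where open ≤-Reasoning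

    offsets : List ℕ
    offsets = filter (λ d → ¬? (d ≟ period)) (applyUpTo suc k)

  length-offsets : ∀ k → length (Heights.offsets k) ≤ k ∸ 1
  length-offsets zero    = z≤n
  length-offsets (suc k) = s≤s⁻¹ (subst (length offsets <_) (length-applyUpTo suc (suc k))
    (filter-notAll (λ d → ¬? (d ≟ period)) (applyUpTo suc (suc k))
      (Any.map (λ period≡d d≢period → d≢period (sym period≡d))
               (∈-applyUpTo⁺ suc (m/n<m (suc k) 2 (s≤s (s≤s z≤n)))))))
    where open Heights (suc k)

module OrderedFieldProperties (R : RealField) where

  open RealField R
  open import Algebra.Properties.Ring (CommutativeRing.ring cring)
    using (xyx⁻¹≈y; -‿distribˡ-*; -‿distribʳ-*; -‿involutive)
  open import Algebra.Properties.Semiring.Mult semiring using (×-homo-+; ×1-homo-*)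
    renaming (_×_ to _×′_)
  open import Relation.Binary.Reasoning.Setoid setoid

  x+[y-x]≈y : ∀ x y → x + (y - x) ≈ y
  x+[y-x]≈y x y = trans (sym (+-assoc x y (- x))) (xyx⁻¹≈y x y)

  [x-y]+y≈x : ∀ x y → (x - y) + y ≈ x
  [x-y]+y≈x x y = trans (+-comm (x - y) y) (x+[y-x]≈y y x)

  x+y-y≈x : ∀ x y → x + y - y ≈ x
  x+y-y≈x x y = trans (+-congʳ (+-comm x y)) (xyx⁻¹≈y y x)

  x≤x+y : ∀ {x y} → 0# ≤ᵣ y → x ≤ᵣ (x + y)
  x≤x+y {x} {y} 0≤y = ≤-resp-≈ (+-identityˡ x) (+-comm y x) (≤-+ x 0≤y)

  x≤y⇒0≤y-x : ∀ {x y} → x ≤ᵣ y → 0# ≤ᵣ (y - x)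
  x≤y⇒0≤y-x {x} {y} x≤y = ≤-resp-≈ (-‿inverseʳ x) refl (≤-+ (- x) x≤y)

  +-cancelʳ-≤ : ∀ {x y} z → (x + z) ≤ᵣ (y + z) → x ≤ᵣ y
  +-cancelʳ-≤ {x} {y} z x+z≤y+z = ≤-resp-≈ (x+y-y≈x x z) (x+y-y≈x y z) (≤-+ (- z) x+z≤y+z)

  0≤x*x : ∀ x → 0# ≤ᵣ (x * x)
  0≤x*x x with ≤-total 0# x
  ... | inj₁ 0≤x = ≤-* 0≤x 0≤x
  ... | inj₂ x≤0 = ≤-resp-≈ refl -x*-x≈x*x (≤-* 0≤-x 0≤-x)
    where
    0≤-x : 0# ≤ᵣ (- x)
    0≤-x = ≤-resp-≈ (-‿inverseʳ x) (+-identityˡ (- x)) (≤-+ (- x) x≤0)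
    -x*-x≈x*x : - x * - x ≈ x * x
    -x*-x≈x*x = begin
      - x * - x    ≈⟨ -‿distribˡ-* x (- x) ⟨
      - (x * - x)  ≈⟨ -‿cong (-‿distribʳ-* x x) ⟨
      - - (x * x)  ≈⟨ -‿involutive (x * x) ⟩
      x * x        ∎

  0≤1 : 0# ≤ᵣ 1#
  0≤1 = ≤-resp-≈ refl (*-identityˡ 1#) (0≤x*x 1#)

  1≰0 : ¬ (1# ≤ᵣ 0#)
  1≰0 1≤0 = 0≉1 (≤-antisym 0≤1 1≤0)

  ι : ℕ → Carrier
  ι n = n ×′ 1#

  ι-homo-+ : ∀ m n → ι (m ℕ.+ n) ≈ ι m + ι n
  ι-homo-+ = ×-homo-+ 1#

  ι-homo-*+* : ∀ a b c d → ι (a ℕ.* b ℕ.+ c ℕ.* d) ≈ ι a * ι b + ι c * ι d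
  ι-homo-*+* a b c d = trans (ι-homo-+ (a ℕ.* b) (c ℕ.* d)) (+-cong (×1-homo-* a b) (×1-homo-* c d))

  ι[m+n]-ιm≈ιn : ∀ m n → ι (m ℕ.+ n) - ι m ≈ ι n
  ι[m+n]-ιm≈ιn m n = trans (+-congʳ (ι-homo-+ m n)) (xyx⁻¹≈y (ι m) (ι n))

  0≤ι : ∀ n → 0# ≤ᵣ ι n
  0≤ι zero    = ≤-refl 0#
  0≤ι (suc n) = ≤-trans 0≤1 (x≤x+y (0≤ι n))

  ι-mono-≤ : ∀ {m n} → m ℕ.≤ n → ι m ≤ᵣ ι n
  ι-mono-≤ {m} m≤n with ℕ.m≤n⇒∃[o]m+o≡n m≤n
  ... | o , ≡.refl = ≤-resp-≈ refl (sym (ι-homo-+ m o)) (x≤x+y (0≤ι o))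

  ι-cancel-≤ : ∀ {m n} → ι m ≤ᵣ ι n → m ℕ.≤ n
  ι-cancel-≤ {m} {n} ιm≤ιn = ℕ.≮⇒≥ λ n<m → 1≰0 (+-cancelʳ-≤ (ι n)
    (≤-resp-≈ refl (sym (+-identityˡ (ι n))) (≤-trans (ι-mono-≤ n<m) ιm≤ιn)))

  ι-injective : ∀ {m n} → ι m ≈ ι n → m ≡ n
  ι-injective ιm≈ιn = ℕ.≤-antisym (ι-cancel-≤ (≤-resp-≈ refl ιm≈ιn (≤-refl _)))
                                  (ι-cancel-≤ (≤-resp-≈ ιm≈ιn refl (≤-refl _)))

module Segments (R : RealField) where

  open RealField R
  open import Data.Nat.Tactic.RingSolver using (solve-∀)
  open import Algebra.Properties.Ring (CommutativeRing.ring cring)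
    using (xyx⁻¹≈y; ⁻¹-anti-homo‿-; -‿distribˡ-*; -‿distribʳ-*)
  open import Algebra.Properties.CommutativeSemigroup *-commutativeSemigroup using (x∙yz≈yx∙z)
  open import Relation.Binary.Reasoning.Setoid setoid
  open OrderedFieldProperties R

  a+t[b-a]+[1-t][b-a]≈b : ∀ a b t → a + t * (b - a) + (1# - t) * (b - a) ≈ b
  a+t[b-a]+[1-t][b-a]≈b a b t = begin
    a + t * (b - a) + (1# - t) * (b - a)    ≈⟨ +-assoc a _ _ ⟩
    a + (t * (b - a) + (1# - t) * (b - a))  ≈⟨ +-congˡ (distribʳ (b - a) t (1# - t)) ⟨
    a + (t + (1# - t)) * (b - a)            ≈⟨ +-congˡ (*-congʳ (x+[y-x]≈y t 1#)) ⟩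
    a + 1# * (b - a)                        ≈⟨ +-congˡ (*-identityˡ (b - a)) ⟩
    a + (b - a)                             ≈⟨ x+[y-x]≈y a b ⟩
    b                                       ∎

  a+t[b-a]≈b+[1-t][a-b] : ∀ a b t → a + t * (b - a) ≈ b + (1# - t) * (a - b)
  a+t[b-a]≈b+[1-t][a-b] a b t = sym (begin
    b + (1# - t) * (a - b)    ≈⟨ +-congˡ (*-congˡ (⁻¹-anti-homo‿- b a)) ⟨
    b + (1# - t) * - (b - a)  ≈⟨ +-congˡ (-‿distribʳ-* (1# - t) (b - a)) ⟨
    b - (1# - t) * (b - a)    ≈⟨ +-congʳ (a+t[b-a]+[1-t][b-a]≈b a b t) ⟨
    a + t * (b - a) + (1# - t) * (b - a) - (1# - t) * (b - a)  ≈⟨ x+y-y≈x _ _ ⟩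
    a + t * (b - a)           ∎)

  onSegment-sym : ∀ {p a b} → OnSegment R p a b → OnSegment R p b a
  onSegment-sym {a = ax , ay} {b = bx , by} (t , 0≤t , t≤1 , px≈ , py≈) =
    1# - t , x≤y⇒0≤y-x t≤1 , ≤-resp-≈ refl ([x-y]+y≈x 1# t) (x≤x+y 0≤t) ,
    trans px≈ (a+t[b-a]≈b+[1-t][a-b] ax bx t) , trans py≈ (a+t[b-a]≈b+[1-t][a-b] ay by t)

  onSegment⇒x-between : ∀ {px py ax ay bx by} → OnSegment R (px , py) (ax , ay) (bx , by) →
                        ax ≤ᵣ bx → (ax ≤ᵣ px) × (px ≤ᵣ bx)
  onSegment⇒x-between {ax = ax} {bx = bx} (t , 0≤t , t≤1 , px≈ , _) ax≤bx =
    ≤-resp-≈ refl (sym px≈) (x≤x+y (≤-* 0≤t 0≤bx-ax)) ,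
    ≤-resp-≈ (sym px≈) (a+t[b-a]+[1-t][b-a]≈b ax bx t) (x≤x+y (≤-* (x≤y⇒0≤y-x t≤1) 0≤bx-ax))
    where 0≤bx-ax = x≤y⇒0≤y-x ax≤bx

  onSegment⇒collinear : ∀ {px py ax ay bx by} → OnSegment R (px , py) (ax , ay) (bx , by) →
    (bx - ax) * py + (px - ax) * ay ≈ (bx - ax) * ay + (px - ax) * by
  onSegment⇒collinear {px} {py} {ax} {ay} {bx} {by} (t , _ , _ , px≈ , py≈) = begin
    S * py + A * ay                ≈⟨ +-congʳ (*-congˡ py≈) ⟩
    S * (ay + t * D) + A * ay      ≈⟨ +-congʳ (distribˡ S ay (t * D)) ⟩
    S * ay + S * (t * D) + A * ay  ≈⟨ +-congʳ (+-congˡ (x∙yz≈yx∙z S t D)) ⟩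
    S * ay + t * S * D + A * ay    ≈⟨ +-congʳ (+-congˡ (*-congʳ A≈tS)) ⟨
    S * ay + A * D + A * ay        ≈⟨ +-assoc (S * ay) (A * D) (A * ay) ⟩
    S * ay + (A * D + A * ay)      ≈⟨ +-congˡ (distribˡ A D ay) ⟨
    S * ay + A * (D + ay)          ≈⟨ +-congˡ (*-congˡ ([x-y]+y≈x by ay)) ⟩
    S * ay + A * by                ∎
    where
    S = bx - ax
    A = px - ax
    D = by - ay
    A≈tS : A ≈ t * S
    A≈tS = trans (+-congʳ px≈) (xyx⁻¹≈y ax (t * S))

  onSegment⇒weighted-mean : ∀ i a c {y₀ y₁ y₂} →
    OnSegment R (ι (i ℕ.+ a) , ι y₁) (ι i , ι y₀) (ι (i ℕ.+ a ℕ.+ c) , ι y₂) →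
    (a ℕ.+ c) ℕ.* y₁ ≡ c ℕ.* y₀ ℕ.+ a ℕ.* y₂
  onSegment⇒weighted-mean i a c {y₀} {y₁} {y₂} seg =
    ℕ.+-cancelʳ-≡ (a ℕ.* y₀) _ _ (≡.trans (ι-injective ι-collinear) (regroup a c y₀ y₂))
    where
    S = ι (i ℕ.+ a ℕ.+ c) - ι i
    A = ι (i ℕ.+ a) - ι i
    A≈ιa : A ≈ ι a
    A≈ιa = ι[m+n]-ιm≈ιn i a
    S≈ι[a+c] : S ≈ ι (a ℕ.+ c)
    S≈ι[a+c] = trans (+-congʳ (reflexive (≡.cong ι (ℕ.+-assoc i a c)))) (ι[m+n]-ιm≈ιn i (a ℕ.+ c))
    ι-collinear : ι ((a ℕ.+ c) ℕ.* y₁ ℕ.+ a ℕ.* y₀) ≈ ι ((a ℕ.+ c) ℕ.* y₀ ℕ.+ a ℕ.* y₂)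
    ι-collinear = begin
      ι ((a ℕ.+ c) ℕ.* y₁ ℕ.+ a ℕ.* y₀)  ≈⟨ ι-homo-*+* (a ℕ.+ c) y₁ a y₀ ⟩
      ι (a ℕ.+ c) * ι y₁ + ι a * ι y₀     ≈⟨ +-cong (*-congʳ S≈ι[a+c]) (*-congʳ A≈ιa) ⟨
      S * ι y₁ + A * ι y₀                 ≈⟨ onSegment⇒collinear seg ⟩
      S * ι y₀ + A * ι y₂                 ≈⟨ +-cong (*-congʳ S≈ι[a+c]) (*-congʳ A≈ιa) ⟩
      ι (a ℕ.+ c) * ι y₀ + ι a * ι y₂     ≈⟨ ι-homo-*+* (a ℕ.+ c) y₀ a y₂ ⟨
      ι ((a ℕ.+ c) ℕ.* y₀ ℕ.+ a ℕ.* y₂)  ∎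
    regroup : ∀ a c y₀ y₂ → (a ℕ.+ c) ℕ.* y₀ ℕ.+ a ℕ.* y₂ ≡ c ℕ.* y₀ ℕ.+ a ℕ.* y₂ ℕ.+ a ℕ.* y₀
    regroup = solve-∀

  hasSlope-sym : ∀ {a b d} → HasSlope R a b d → HasSlope R b a d
  hasSlope-sym {ax , ay} {bx , by} {dx , dy} slope = begin
    (ax - bx) * dy      ≈⟨ *-congʳ (⁻¹-anti-homo‿- bx ax) ⟨
    - (bx - ax) * dy    ≈⟨ -‿distribˡ-* (bx - ax) dy ⟨
    - ((bx - ax) * dy)  ≈⟨ -‿cong slope ⟩
    - ((by - ay) * dx)  ≈⟨ -‿distribˡ-* (by - ay) dx ⟩
    - (by - ay) * dx    ≈⟨ *-congʳ (⁻¹-anti-homo‿- by ay) ⟩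
    (ay - by) * dx      ∎

  hasSlope-step : ∀ i d y y′ → HasSlope R (ι i , y) (ι (i ℕ.+ d) , y′) (ι d , y′ - y)
  hasSlope-step i d y y′ = trans (*-congʳ (ι[m+n]-ιm≈ιn i d)) (*-comm (ι d) (y′ - y))

  horizontal : Point R
  horizontal = 1# , 0#

  horizontal-nonZero : NonZeroDir R horizontal
  horizontal-nonZero (1≈0 , _) = 0≉1 (sym 1≈0)

  hasSlope-horizontal : ∀ {x x′ y y′} → y ≈ y′ → HasSlope R (x , y) (x′ , y′) horizontal
  hasSlope-horizontal {x} {x′} {y} {y′} y≈y′ = begin
    (x′ - x) * 0#  ≈⟨ zeroʳ (x′ - x) ⟩
    0#             ≈⟨ zeroˡ 1# ⟨
    0# * 1#        ≈⟨ *-congʳ (-‿inverseʳ y′) ⟨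
    (y′ - y′) * 1# ≈⟨ *-congʳ (+-congˡ (-‿cong y≈y′)) ⟨
    (y′ - y) * 1#  ∎

module SlopeSets (R : RealField) {n} {G : Graph n} (D : Drawing R G) where

  open import Data.Fin using (_↑ˡ_; splitAt)
  open import Data.Fin.Properties using (splitAt-↑ˡ)
  open import Data.List.Membership.Propositional.Properties using (∈-lookup)
  open import Data.List.Relation.Unary.Any.Properties using (lookup-index)
  open Segments R using (horizontal; horizontal-nonZero)
  open Drawing D

  usesAtMostSlopes-fromList : (L : List (Point R)) → (∀ {s} → s ∈ L → NonZeroDir R s) →
    (∀ u v → Edge G u v → Any (HasSlope R (pos u) (pos v)) L) → UsesAtMostSlopes R D (length L)
  usesAtMostSlopes-fromList L nonZero cover =
    lookup L , (λ i → nonZero (∈-lookup i)) ,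
    λ u v e → Any.index (cover u v e) , lookup-index (cover u v e)

  usesAtMostSlopes-mono : ∀ {m m′} → m ℕ.≤ m′ → UsesAtMostSlopes R D m → UsesAtMostSlopes R D m′
  usesAtMostSlopes-mono {m} m≤m′ (s , nonZero , cover) with ℕ.m≤n⇒∃[o]m+o≡n m≤m′
  ... | o , ≡.refl = padded , padded-nonZero , padded-cover
    where
    padded : Fin (m ℕ.+ o) → Point R
    padded i = [ s , (λ _ → horizontal) ]′ (splitAt m i)
    padded-nonZero : ∀ i → NonZeroDir R (padded i)
    padded-nonZero i with splitAt m i
    ... | inj₁ j = nonZero j
    ... | inj₂ _ = horizontal-nonZero
    padded-cover : ∀ u v → Edge G u v → ∃[ i ] HasSlope R (pos u) (pos v) (padded i)
    padded-cover u v e with cover u v e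
    ... | i , slope = i ↑ˡ o , ≡.subst (HasSlope R (pos u) (pos v)) padded-↑ˡ slope
      where
      padded-↑ˡ : s i ≡ padded (i ↑ˡ o)
      padded-↑ˡ = ≡.cong [ s , (λ _ → horizontal) ]′ (≡.sym (splitAt-↑ˡ m i o))

module Construction (R : RealField) (k : ℕ) where

  open RealField R
  open import Data.Nat.DivMod using (_%_; _/_; m%n<n)
  open import Data.List.Membership.Propositional.Properties
    using ( ∈-cartesianProductWith⁺; ∈-cartesianProductWith⁻; ∈-upTo⁺
          ; ∈-applyUpTo⁺; ∈-applyUpTo⁻; ∈-filter⁺; ∈-filter⁻)
  open import Data.List.Properties using (length-upTo)
  open OrderedFieldProperties R
  open Segments R
  open Arithmetic using (length-cartesianProductWith; length-offsets)
  open Arithmetic.Heights k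

  point : ℕ → Point R
  point i = ι i , ι (height i)

  no-point-inside-short-segment : ∀ {i m j} → i ℕ.≤ j → j ℕ.≤ i ℕ.+ k → m ≢ i → m ≢ j →
                                  ¬ OnSegment R (point m) (point i) (point j)
  no-point-inside-short-segment {i} {m} {j} i≤j j≤i+k m≢i m≢j seg
    with onSegment⇒x-between seg (ι-mono-≤ i≤j)
  ... | ιi≤ιm , ιm≤ιj
    with ℕ.m≤n⇒∃[o]m+o≡n (ι-cancel-≤ {i} {m} ιi≤ιm) | ℕ.m≤n⇒∃[o]m+o≡n (ι-cancel-≤ {m} {j} ιm≤ιj)
  ... | a , ≡.refl | c , ≡.refl =
    height-not-weighted-mean i a c {{a≢0}} {{c≢0}} a+c≤k (onSegment⇒weighted-mean i a c seg)
    where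
    a≢0 : ℕ.NonZero a
    a≢0 = ℕ.≢-nonZero λ a≡0 → m≢i (≡.trans (≡.cong (i ℕ.+_) a≡0) (ℕ.+-identityʳ i))
    c≢0 : ℕ.NonZero c
    c≢0 = ℕ.≢-nonZero λ c≡0 →
      m≢j (≡.sym (≡.trans (≡.cong (i ℕ.+ a ℕ.+_) c≡0) (ℕ.+-identityʳ (i ℕ.+ a))))
    a+c≤k : a ℕ.+ c ℕ.≤ k
    a+c≤k = ℕ.+-cancelˡ-≤ i _ _ (≡.subst (ℕ._≤ i ℕ.+ k) (ℕ.+-assoc i a c) j≤i+k)

  direction : ℕ → ℕ → Point R
  direction r d = ι d , ι (height (r ℕ.+ d)) - ι (height r)

  slopes : List (Point R)
  slopes = horizontal ∷ cartesianProductWith direction (upTo period) offsets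

  slopes-nonZero : ∀ {s} → s ∈ slopes → NonZeroDir R s
  slopes-nonZero (here ≡.refl) = horizontal-nonZero
  slopes-nonZero (there s∈) with ∈-cartesianProductWith⁻ direction (upTo period) offsets s∈
  ... | _ , d , _ , d∈offsets , ≡.refl
    with ∈-applyUpTo⁻ suc (proj₁ (∈-filter⁻ (λ d → ¬? (d ℕ.≟ period)) {xs = applyUpTo suc k}
                                             d∈offsets))
  ... | q , _ , ≡.refl = λ (ι[1+q]≈0 , _) → ℕ.1+n≢0 (ι-injective {suc q} {0} ι[1+q]≈0)

  length-slopes : length slopes ℕ.≤ k ℕ.* (k ℕ.+ 1) / 2 ℕ.+ 1
  length-slopes = begin
    suc (length (cartesianProductWith direction (upTo period) offsets))
      ≡⟨ ≡.cong suc (length-cartesianProductWith direction (upTo period) offsets) ⟩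
    suc (length (upTo period) ℕ.* length offsets)
      ≡⟨ ≡.cong (λ l → suc (l ℕ.* length offsets)) (length-upTo period) ⟩
    suc (period ℕ.* length offsets)
      ≤⟨ ℕ.s≤s (ℕ.*-monoʳ-≤ period (length-offsets k)) ⟩
    suc (period ℕ.* (k ℕ.∸ 1))
      ≤⟨ ℕ.s≤s period*[k∸1]≤k[k+1]/2 ⟩
    suc (k ℕ.* (k ℕ.+ 1) / 2)
      ≡⟨ ℕ.+-comm 1 _ ⟩
    k ℕ.* (k ℕ.+ 1) / 2 ℕ.+ 1 ∎
    where open ℕ.≤-Reasoning

  step-slope : ∀ i q → q ℕ.< k → Any (HasSlope R (point i) (point (i ℕ.+ suc q))) slopes
  step-slope i q q<k with suc q ℕ.≟ period
  ... | yes ≡.refl = here (hasSlope-horizontal (reflexive (≡.cong ι (≡.sym (height-periodic i)))))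
  ... | no d≢period =
    there (lose (∈-cartesianProductWith⁺ direction (∈-upTo⁺ (m%n<n i period)) d∈offsets) slope)
    where
    d = suc q
    d∈offsets : d ∈ offsets
    d∈offsets = ∈-filter⁺ (λ d → ¬? (d ℕ.≟ period)) (∈-applyUpTo⁺ suc q<k) d≢period
    direction-% : direction (i % period) d ≡ (ι d , ι (height (i ℕ.+ d)) - ι (height i))
    direction-% = ≡.cong₂ (λ y′ y → ι d , ι y′ - ι y) (height-%-+ i d) (height-% i)
    slope : HasSlope R (point i) (point (i ℕ.+ d)) (direction (i % period) d)
    slope = ≡.subst (HasSlope R (point i) (point (i ℕ.+ d))) (≡.sym direction-%)
                    (hasSlope-step i d (ι (height i)) (ι (height (i ℕ.+ d))))

  edge-slope : ∀ {i j} → i ℕ.< j → j ℕ.≤ i ℕ.+ k → Any (HasSlope R (point i) (point j)) slopes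
  edge-slope {i} i<j j≤i+k with ℕ.m≤n⇒∃[o]m+o≡n i<j
  ... | q , ≡.refl = ≡.subst (λ j → Any (HasSlope R (point i) (point j)) slopes) (ℕ.+-suc i q)
    (step-slope i q (ℕ.+-cancelˡ-≤ i (suc q) k
      (≡.subst (ℕ._≤ i ℕ.+ k) (≡.sym (ℕ.+-suc i q)) j≤i+k)))

module Bandwidth where

  open import Data.Nat using (_≤_; ∣_-_∣)
  open import Data.Fin.Properties using (toℕ-injective)
  open import Data.Nat.Properties using (m⊔n≤o⇒m≤o; m⊔n≤o⇒n≤o)
  open import Data.List.Properties using (foldr-forcesᵇ)
  open import Data.List.Relation.Unary.All.Properties using (concat⁻; map⁻; tabulate⁻)

  width≤⇒entry≤ : ∀ {n} (G : Graph n) σ {k} → width G σ ≤ k → ∀ i j →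
                  adj G (σ ⟨$⟩ʳ i) (σ ⟨$⟩ʳ j) ≡ true → ∣ toℕ i - toℕ j ∣ ≤ k
  width≤⇒entry≤ G σ {k} width≤k i j edge =
    ≡.subst (λ b → (if b then ∣ toℕ i - toℕ j ∣ else 0) ≤ k) edge
    (tabulate⁻ (map⁻ (tabulate⁻ (map⁻ (concat⁻ entries≤k)) i)) j)
    where
    entries≤k = foldr-forcesᵇ (λ x y x⊔y≤k → m⊔n≤o⇒m≤o x y x⊔y≤k , m⊔n≤o⇒n≤o x y x⊔y≤k) 0 _ width≤k

  position : ∀ {n} → Permutation′ n → Fin n → ℕ
  position σ u = toℕ (σ ⟨$⟩ˡ u)

  position-injective : ∀ {n} (σ : Permutation′ n) {u v} → position σ u ≡ position σ v → u ≡ v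
  position-injective σ eq =
    ≡.trans (≡.sym (inverseʳ σ)) (≡.trans (≡.cong (σ ⟨$⟩ʳ_) (toℕ-injective eq)) (inverseʳ σ))

  width≤⇒edge-span≤ : ∀ {n} (G : Graph n) σ {k} → width G σ ≤ k →
                      ∀ {u v} → Edge G u v → ∣ position σ u - position σ v ∣ ≤ k
  width≤⇒edge-span≤ G σ width≤k {u} {v} edge = width≤⇒entry≤ G σ width≤k (σ ⟨$⟩ˡ u) (σ ⟨$⟩ˡ v)
    (≡.subst₂ (λ u v → adj G u v ≡ true) (≡.sym (inverseʳ σ)) (≡.sym (inverseʳ σ)) edge)

module BandedDrawing (R : RealField) {n} (G : Graph n) (k : ℕ) (position : Fin n → ℕ)
                     (position-injective : ∀ {u v} → position u ≡ position v → u ≡ v)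
                     (edge-span : ∀ {u v} → Edge G u v → ℕ.∣ position u - position v ∣ ℕ.≤ k) where

  open import Data.Nat.DivMod using (_/_)
  open import Data.Empty using (⊥-elim)
  open import Function using (_∘_)
  open import Relation.Binary.Definitions using (tri<; tri≈; tri>)
  open OrderedFieldProperties R using (ι-injective)
  open Segments R using (onSegment-sym; hasSlope-sym)
  open Construction R k

  edge-sym : ∀ {u v} → Edge G u v → Edge G v u
  edge-sym {u} {v} e = ≡.trans (symm G v u) e

  edge-irrefl : ∀ {u} → ¬ Edge G u u
  edge-irrefl {u} e with ≡.trans (≡.sym e) (irrefl G u)
  ... | ()

  span-≤ : ∀ {u v} → Edge G u v → position u ℕ.≤ position v ℕ.+ k
  span-≤ {u} {v} e =
    ℕ.≤-trans (ℕ.m≤n+∣m-n∣ (position u) (position v)) (ℕ.+-monoʳ-≤ (position v) (edge-span e))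

  drawing : Drawing R G
  Drawing.pos drawing u = point (position u)
  Drawing.distinct drawing u v u≢v (x≈ , _) = u≢v (position-injective (ι-injective x≈))
  Drawing.noVertexOnEdge drawing u v w e w≢u w≢v seg with ℕ.≤-total (position u) (position v)
  ... | inj₁ pu≤pv = no-point-inside-short-segment pu≤pv (span-≤ (edge-sym e))
                       (w≢u ∘ position-injective) (w≢v ∘ position-injective) seg
  ... | inj₂ pv≤pu = no-point-inside-short-segment pv≤pu (span-≤ e)
                       (w≢v ∘ position-injective) (w≢u ∘ position-injective) (onSegment-sym seg)

  edge-slopes : ∀ u v → Edge G u v →
                Any (HasSlope R (point (position u)) (point (position v))) slopes
  edge-slopes u v e with ℕ.<-cmp (position u) (position v)
  ... | tri< pu<pv _ _ = edge-slope pu<pv (span-≤ (edge-sym e))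
  ... | tri≈ _ pu≡pv _ =
    ⊥-elim (edge-irrefl (≡.subst (Edge G u) (≡.sym (position-injective pu≡pv)) e))
  ... | tri> _ _ pv<pu = Any.map hasSlope-sym (edge-slope pv<pu (span-≤ e))

  slopeNumber≤ : SlopeNumberAtMost R G (k ℕ.* (k ℕ.+ 1) / 2 ℕ.+ 1)
  slopeNumber≤ = drawing , usesAtMostSlopes-mono length-slopes
                             (usesAtMostSlopes-fromList slopes slopes-nonZero edge-slopes)
    where open SlopeSets R drawing

open import Data.Nat using (_+_; _*_; _/_)
open Bandwidth using (position; position-injective; width≤⇒edge-span≤)

theorem4 : (R : RealField) → (n : ℕ) → (G : Graph n) → (k : ℕ) →
           BandwidthAtMost G k →
           SlopeNumberAtMost R G ((k * (k + 1)) / 2 + 1)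
theorem4 R n G k (σ , width≤k) =
  BandedDrawing.slopeNumber≤ R G k (position σ) (position-injective σ)
                             (width≤⇒edge-span≤ G σ width≤k)
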